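{- Let $t$ be a tree, let $m\ge 2$ be a number and let $S$ be a zone of $t$ with more than $m$ nodes. Then $S$ can be partitioned into at most five zones, one of which has at least $\frac12 m$ and at most $m$ nodes.
   Context: Trees are finite ordered unranked trees. A zone of $t$ is a set $S$ of nodes of $t$ such that: $S$ is a subforest of $t$ (a forest of subtrees of $t$, possibly with parts removed, whose roots are consecutive siblings); for every $v\in S$, either none or all of the children of $v$ in $t$ belong to $S$; and there is at most one node $v_S\in S$ that has children in $t$ none of which are in $S$ (the vertical connection node). Equivalently, zones are of one of the forms: the subtree rooted at a node $v$; the forest of subtrees rooted at consecutive siblings $u,\dots,v$; or one of these two with the proper descendants of one node $w$ removed. -}

module Defs where

open import Data.Nat using (ℕ; zero; suc; _≤_; _<_; _*_)
open import Data.Bool using (Bool; true; false; T; if_then_else_)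
open import Data.List using (List; []; _∷_; _++_; length; filterᵇ)
open import Data.List.Relation.Unary.All using (All)
open import Data.List.Relation.Unary.Any using (Any)
open import Data.Maybe using (Maybe; just; nothing; _>>=_; maybe)
open import Data.Product using (Σ; ∃; _×_; _,_)
open import Data.Sum using (_⊎_)
open import Relation.Binary.PropositionalEquality using (_≡_)
open import Relation.Nullary using (¬_)

data Tree : Set where
  node : List Tree → Tree

children : Tree → List Tree
children (node ts) = ts

-- A node is addressed by its path from the root, stored REVERSED:
-- the head is the last step.  So the i-th child of p is (i ∷ p),
-- and the parent of (i ∷ p) is p.  The root is [].
Pos : Set
Pos = List ℕ

nth : ℕ → List Tree → Maybe Tree
nth _ [] = nothing
nth zero (t ∷ ts) = just t
nth (suc i) (t ∷ ts) = nth i ts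

sub : Tree → Pos → Maybe Tree
sub t [] = just t
sub t (i ∷ p) = sub t p >>= λ u → nth i (children u)

IsNode : Tree → Pos → Set
IsNode t p = Σ Tree λ u → sub t p ≡ just u

-- number of children of node p in t (0 if p is not a node)
arity : Tree → Pos → ℕ
arity t p = maybe (λ u → length (children u)) 0 (sub t p)

mutual
  nodesFrom : Pos → Tree → List Pos
  nodesFrom p (node ts) = p ∷ nodesList p 0 ts

  nodesList : Pos → ℕ → List Tree → List Pos
  nodesList p i [] = []
  nodesList p i (u ∷ us) = nodesFrom (i ∷ p) u ++ nodesList p (suc i) us

nodes : Tree → List Pos
nodes t = nodesFrom [] t

NodeSet : Set
NodeSet = Pos → Bool

size : Tree → NodeSet → ℕ
size t S = length (filterᵇ S (nodes t))

IsRootOf : NodeSet → Pos → Set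
IsRootOf S [] = T (S [])
IsRootOf S (i ∷ p) = T (S (i ∷ p)) × ¬ T (S p)

IsVCNode : Tree → NodeSet → Pos → Set
IsVCNode t S v = T (S v) × (0 < arity t v) × (∀ i → i < arity t v → ¬ T (S (i ∷ v)))

record Zone (t : Tree) (S : NodeSet) : Set where
  field
    inTree   : ∀ p → T (S p) → IsNode t p
    nonempty : ∃ λ p → T (S p)
    rootsSiblings : ∀ p q → IsRootOf S p → IsRootOf S q →
                    p ≡ q ⊎ Σ ℕ λ i → Σ ℕ λ j → Σ Pos λ r → p ≡ i ∷ r × q ≡ j ∷ r
    rootsConsecutive : ∀ r i j k → IsRootOf S (i ∷ r) → IsRootOf S (j ∷ r) →
                       i ≤ k → k ≤ j → IsRootOf S (k ∷ r)
    childrenAllOrNone : ∀ v → T (S v) →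
                        (∀ i → i < arity t v → ¬ T (S (i ∷ v))) ⊎
                        (∀ i → i < arity t v → T (S (i ∷ v)))
    atMostOneVC : ∀ v w → IsVCNode t S v → IsVCNode t S w → v ≡ w

IsPartition : NodeSet → List NodeSet → Set
IsPartition S Ss = ∀ p → length (filterᵇ (λ Z → Z p) Ss) ≡ (if S p then 1 else 0)

{-# OPTIONS --safe #-}
module Submission where

-- A zone is the same thing as a nonempty region: the subtrees rooted at the consecutive
-- children a, …, b−1 of a node r (or the whole tree), with the proper descendants of one
-- node h of the region removed (h is the vertical connection node, or any leaf of the zone
-- if there is none).  Region sizes are additive along splits of the child range and along
-- cutting off everything below a node, so the proof is an accounting of subtree weights.
--
-- Climb from h to the highest ancestor x whose descendants in S number at most m.  If they
-- number at least m/2, cut them off: two zones.  Otherwise x is a root of S, or its parent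
-- has more than m descendants in S; either way a run of siblings of x of total weight more
-- than m contains x, whose own weight (itself and its descendants) is at most m.  If the
-- heaviest sibling weighs at most m, some contiguous run of siblings weighs between m/2 and
-- m.  If not, it is not x, so nothing is removed below it, and descending along heaviest
-- children reaches a node whose descendants, or a prefix of whose children's subtrees,
-- number between m/2 and m.  Each case cuts S into at most five regions; the empty ones are
-- dropped.

open import Defs
open import Data.Bool using (Bool; true; false; T; if_then_else_; _∧_; not)
open import Data.Bool.Properties using (∧-identityʳ; ∧-zeroʳ; T-≡; T-∧)
open import Data.Empty using (⊥; ⊥-elim)
open import Data.List using (List; []; _∷_; _++_; length; filterᵇ)
open import Data.List.Membership.Propositional using (_∈_)
open import Data.List.Membership.Propositional.Properties using (∈-++⁺ˡ; ∈-++⁺ʳ)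
open import Data.List.Properties using (≡-dec; filter-++; length-++; length-filter)
open import Data.List.Relation.Unary.All as All using (All; []; _∷_)
open import Data.List.Relation.Unary.All.Properties using (++⁺)
open import Data.List.Relation.Unary.Any using (Any; here; there)
open import Data.List.Relation.Unary.Any.Properties using () renaming (++⁺ˡ to any-++⁺ˡ; ++⁺ʳ to any-++⁺ʳ)
open import Data.Maybe using (Maybe; just; nothing; is-just; maybe)
open import Data.Maybe.Properties using (just-injective)
open import Data.Nat using (ℕ; zero; suc; _+_; _*_; _∸_; _≤_; _<_; z≤n; s≤s; _≤?_; _<?_; _≟_; _<ᵇ_)
open import Data.Nat.Properties
open import Algebra.Properties.CommutativeSemigroup +-commutativeSemigroup using (interchange)
open import Data.Product using (Σ; _×_; _,_; proj₁; proj₂)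
open import Data.Sum using (_⊎_; inj₁; inj₂; [_,_])
open import Data.Unit using (tt)
open import Function using (_∘_; Equivalence)
open import Relation.Binary.Definitions using (tri<; tri≈; tri>)
open import Relation.Binary.PropositionalEquality hiding ([_])
open import Relation.Nullary using (¬_; yes; no; Dec)
open import Relation.Nullary.Decidable using (⌊_⌋; T?; toWitness; fromWitness; isYes≗does; dec-true; dec-false)

⌊⌋-true : ∀ {P : Set} (d : Dec P) → P → ⌊ d ⌋ ≡ true
⌊⌋-true d p = trans (isYes≗does d) (dec-true d p)

⌊⌋-false : ∀ {P : Set} (d : Dec P) → ¬ P → ⌊ d ⌋ ≡ false
⌊⌋-false d ¬p = trans (isYes≗does d) (dec-false d ¬p)

T⇒≡true : ∀ {b} → T b → b ≡ true
T⇒≡true = Equivalence.to T-≡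

≡true⇒T : ∀ {b} → b ≡ true → T b
≡true⇒T = Equivalence.from T-≡

T-∧⁻ : ∀ {a b} → T (a ∧ b) → T a × T b
T-∧⁻ {a} {b} = Equivalence.to (T-∧ {a} {b})

T-∧⁺ : ∀ {a b} → T a → T b → T (a ∧ b)
T-∧⁺ {a} {b} Ta Tb = Equivalence.from (T-∧ {a} {b}) (Ta , Tb)

T-not⁻ : ∀ {a} → T (not a) → ¬ T a
T-not⁻ {false} _ ()

T-not⁺ : ∀ {a} → ¬ T a → T (not a)
T-not⁺ {false} _ = tt
T-not⁺ {true} ¬a = ¬a tt

≡false⇒¬T : ∀ {b} → b ≡ false → ¬ T b
≡false⇒¬T refl ()

¬T-not⇒T : ∀ {b} → ¬ T (not b) → T b
¬T-not⇒T {true} _ = tt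
¬T-not⇒T {false} ¬T = ⊥-elim (¬T tt)

T-⇔⇒≡ : ∀ {a b} → (T a → T b) → (T b → T a) → a ≡ b
T-⇔⇒≡ {false} {false} _ _ = refl
T-⇔⇒≡ {false} {true} _ b⇒a = ⊥-elim (b⇒a tt)
T-⇔⇒≡ {true} {false} a⇒b _ = ⊥-elim (a⇒b tt)
T-⇔⇒≡ {true} {true} _ _ = refl

least : (f : ℕ → Bool) → ∀ n → T (f n) → Σ ℕ λ a → a ≤ n × T (f a) × (∀ j → j < a → ¬ T (f j))
least f n fn with f 0 in e
... | true = 0 , z≤n , ≡true⇒T e , λ j ()
least f zero fn | false = ⊥-elim (≡false⇒¬T e fn)
least f (suc n) fn | false with least (f ∘ suc) n fn
... | (a , a≤n , fa , before) = suc a , s≤s a≤n , fa , λ { zero _ → ≡false⇒¬T e ; (suc j) (s≤s j<a) → before j j<a }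

χ : Bool → ℕ
χ b = if b then 1 else 0

infix 4 _≐_⊎_

_≐_⊎_ : {A : Set} → (A → Bool) → (A → Bool) → (A → Bool) → Set
P ≐ Q ⊎ R = ∀ x → χ (P x) ≡ χ (Q x) + χ (R x)

count : {A : Set} → (A → Bool) → List A → ℕ
count P l = length (filterᵇ P l)

count-∷ : {A : Set} (P : A → Bool) (x : A) (l : List A) → count P (x ∷ l) ≡ χ (P x) + count P l
count-∷ P x l with P x
... | true = refl
... | false = refl

count-++ : {A : Set} (P : A → Bool) (l l' : List A) → count P (l ++ l') ≡ count P l + count P l'
count-++ P l l' = trans (cong length (filter-++ (T? ∘ P) l l')) (length-++ (filterᵇ P l))

count-additive : {A : Set} (P Q R : A → Bool) → P ≐ Q ⊎ R →
                 ∀ l → count P l ≡ count Q l + count R l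
count-additive P Q R h [] = refl
count-additive P Q R h (x ∷ l)
  rewrite count-∷ P x l | count-∷ Q x l | count-∷ R x l | count-additive P Q R h l | h x =
  interchange (χ (Q x)) (χ (R x)) (count Q l) (count R l)

count-mono : {A : Set} (P Q : A → Bool) → (∀ x → χ (P x) ≤ χ (Q x)) → ∀ l → count P l ≤ count Q l
count-mono P Q h [] = z≤n
count-mono P Q h (x ∷ l) rewrite count-∷ P x l | count-∷ Q x l = +-mono-≤ (h x) (count-mono P Q h l)

count-cong : {A : Set} (P Q : A → Bool) → (∀ x → P x ≡ Q x) → ∀ l → count P l ≡ count Q l
count-cong P Q h l = cong length (filter-≗ l)
  where
  filter-≗ : ∀ l → filterᵇ P l ≡ filterᵇ Q l
  filter-≗ [] = refl
  filter-≗ (x ∷ l) rewrite h x with Q x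
  ... | true = cong (x ∷_) (filter-≗ l)
  ... | false = filter-≗ l

count-const-false : {A : Set} (l : List A) → count (λ _ → false) l ≡ 0
count-const-false [] = refl
count-const-false (x ∷ l) = count-const-false l

count≡0⇒false : {A : Set} (P : A → Bool) (l : List A) → count P l ≡ 0 → ∀ x → x ∈ l → P x ≡ false
count≡0⇒false P (y ∷ l) e x (here refl) with P y
... | true = ⊥-elim (1+n≢0 e)
... | false = refl
count≡0⇒false P (y ∷ l) e x (there x∈l) with P y
... | true = ⊥-elim (1+n≢0 e)
... | false = count≡0⇒false P l e x x∈l

count>0⇒witness : {A : Set} (P : A → Bool) (l : List A) → 0 < count P l → Σ A λ x → x ∈ l × T (P x)
count>0⇒witness P (y ∷ l) h with P y in eq
... | true = y , here refl , ≡true⇒T eq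
... | false with count>0⇒witness P l h
... | (x , x∈l , px) = x , there x∈l , px

count-∈ : {A : Set} (P : A → Bool) (l : List A) (x : A) → x ∈ l → T (P x) → 1 ≤ count P l
count-∈ P (y ∷ l) x (here refl) px with P y
... | true = s≤s z≤n
count-∈ P (y ∷ l) x (there x∈l) px with P y
... | true = s≤s z≤n
... | false = count-∈ P l x x∈l px

count-none : {A : Set} (P : A → Bool) (Q : A → Set) (l : List A) →
             All Q l → (∀ x → T (P x) → ¬ Q x) → count P l ≡ 0
count-none P Q [] [] h = refl
count-none P Q (y ∷ l) (qy ∷ ql) h with P y in eq
... | true = ⊥-elim (h y (≡true⇒T eq) qy)
... | false = count-none P Q l ql h

_≟ₚ_ : (x y : Pos) → Dec (x ≡ y)
_≟ₚ_ = ≡-dec _≟_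

-- branch r p ≡ just k  iff  p lies in the subtree of the k-th child of r.
branch : Pos → Pos → Maybe ℕ
branch r [] = nothing
branch r (k ∷ p) = if ⌊ p ≟ₚ r ⌋ then just k else branch r p

IsJust : Maybe ℕ → Set
IsJust m = T (is-just m)

just⇒IsJust : ∀ {m k} → m ≡ just k → IsJust m
just⇒IsJust refl = tt

IsJust⇒just : ∀ m → IsJust m → Σ ℕ λ k → m ≡ just k
IsJust⇒just (just k) _ = k , refl

infix 4 _⊏_ _⊑_

_⊏_ : Pos → Pos → Set
r ⊏ p = IsJust (branch r p)

_⊑_ : Pos → Pos → Set
x ⊑ p = x ≡ p ⊎ x ⊏ p

branch-child : ∀ r k → branch r (k ∷ r) ≡ just k
branch-child r k with r ≟ₚ r
... | yes _ = refl
... | no r≢r = ⊥-elim (r≢r refl)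

⊏-child : ∀ r k → r ⊏ k ∷ r
⊏-child r k = just⇒IsJust (branch-child r k)

branch⇒length< : ∀ r p k → branch r p ≡ just k → length r < length p
branch⇒length< r (j ∷ p) k e with p ≟ₚ r
... | yes refl = ≤-refl
... | no _ = m<n⇒m<1+n (branch⇒length< r p k e)

branch-self : ∀ r → branch r r ≡ nothing
branch-self r with branch r r in e
... | nothing = refl
... | just k = ⊥-elim (<-irrefl refl (branch⇒length< r r k e))

branch-extend : ∀ r p j k → branch r p ≡ just k → branch r (j ∷ p) ≡ just k
branch-extend r p j k e with p ≟ₚ r
... | no _ = e
... | yes refl with trans (sym (branch-self r)) e
... | ()

branch-∷ : ∀ r j p k → branch r (j ∷ p) ≡ just k → (p ≡ r × j ≡ k) ⊎ branch r p ≡ just k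
branch-∷ r j p k e with p ≟ₚ r
branch-∷ r j p k refl | yes p≡r = inj₁ (p≡r , refl)
... | no _ = inj₂ e

branch-trans : ∀ h p r j k → branch h p ≡ just j → branch r h ≡ just k → branch r p ≡ just k
branch-trans h (i ∷ p) r j k e₁ e₂ with branch-∷ h i p j e₁
... | inj₁ (refl , _) = branch-extend r p i k e₂
... | inj₂ e = branch-extend r p i k (branch-trans h p r j k e e₂)

branch-split : ∀ r p k → branch r p ≡ just k → p ≡ k ∷ r ⊎ k ∷ r ⊏ p
branch-split r (j ∷ p) k e with branch-∷ r j p k e
... | inj₁ (refl , refl) = inj₁ refl
... | inj₂ e' with branch-split r p k e'
... | inj₁ refl = inj₂ (⊏-child (k ∷ r) j)
... | inj₂ k∷r⊏p with IsJust⇒just _ k∷r⊏p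
... | (i , e'') = inj₂ (just⇒IsJust (branch-extend (k ∷ r) p j i e''))

[]⊏∷ : ∀ j p → [] ⊏ j ∷ p
[]⊏∷ j [] = tt
[]⊏∷ j (i ∷ p) with IsJust⇒just _ ([]⊏∷ i p)
... | (k , e) = just⇒IsJust (branch-extend [] (i ∷ p) j k e)

child⊑⇒branch : ∀ k r p → k ∷ r ⊑ p → branch r p ≡ just k
child⊑⇒branch k r p (inj₁ refl) = branch-child r k
child⊑⇒branch k r p (inj₂ k∷r⊏p) with IsJust⇒just _ k∷r⊏p
... | (j , e) = branch-trans (k ∷ r) p r j k e (branch-child r k)

⊏-trans : ∀ x y p → x ⊏ y → y ⊏ p → x ⊏ p
⊏-trans x y p x⊏y y⊏p with IsJust⇒just _ x⊏y | IsJust⇒just _ y⊏p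
... | (k , e₁) | (j , e₂) = just⇒IsJust (branch-trans y p x j k e₂ e₁)

⊑-trans : ∀ x y p → x ⊑ y → y ⊑ p → x ⊑ p
⊑-trans x y p (inj₁ refl) y⊑p = y⊑p
⊑-trans x y p (inj₂ x⊏y) (inj₁ refl) = inj₂ x⊏y
⊑-trans x y p (inj₂ x⊏y) (inj₂ y⊏p) = inj₂ (⊏-trans x y p x⊏y y⊏p)

⊑⇒length≤ : ∀ x y → x ⊑ y → length x ≤ length y
⊑⇒length≤ x y (inj₁ refl) = ≤-refl
⊑⇒length≤ x y (inj₂ x⊏y) with IsJust⇒just _ x⊏y
... | (k , e) = <⇒≤ (branch⇒length< x y k e)

just≢nothing : {A : Set} {x : A} → just x ≢ nothing
just≢nothing ()

BranchFrom : Pos → ℕ → Pos → Set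
BranchFrom p i y = Σ ℕ λ k → i ≤ k × branch p y ≡ just k

mutual
  nodesFrom-⊑ : ∀ p u → All (p ⊑_) (nodesFrom p u)
  nodesFrom-⊑ p (node ts) =
    inj₁ refl ∷ All.map (λ { (k , _ , e) → inj₂ (just⇒IsJust e) }) (nodesList-branch p 0 ts)

  nodesList-branch : ∀ p i us → All (BranchFrom p i) (nodesList p i us)
  nodesList-branch p i [] = []
  nodesList-branch p i (u ∷ us) =
    ++⁺ (All.map (λ {y} i∷p⊑y → i , ≤-refl , child⊑⇒branch i p y i∷p⊑y) (nodesFrom-⊑ (i ∷ p) u))
        (All.map (λ { (k , i<k , e) → k , <⇒≤ i<k , e }) (nodesList-branch p (suc i) us))

occurrences : Pos → List Pos → ℕ
occurrences x = count (λ y → ⌊ y ≟ₚ x ⌋)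

occurrences-none : ∀ x (Q : Pos → Set) l → All Q l → ¬ Q x → occurrences x l ≡ 0
occurrences-none x Q l all ¬Qx = count-none _ Q l all λ y y≟x Qy → ¬Qx (subst Q (toWitness y≟x) Qy)

mutual
  nodesFrom-unique : ∀ x p u → occurrences x (nodesFrom p u) ≤ 1
  nodesFrom-unique x p (node ts) rewrite count-∷ (λ y → ⌊ y ≟ₚ x ⌋) p (nodesList p 0 ts) with p ≟ₚ x
  ... | no _ = nodesList-unique x p 0 ts
  ... | yes refl rewrite occurrences-none p (BranchFrom p 0) (nodesList p 0 ts) (nodesList-branch p 0 ts)
                           (λ { (k , _ , e) → just≢nothing (trans (sym e) (branch-self p)) }) = ≤-refl

  nodesList-unique : ∀ x p i us → occurrences x (nodesList p i us) ≤ 1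
  nodesList-unique x p i [] = z≤n
  nodesList-unique x p i (u ∷ us)
    rewrite count-++ (λ y → ⌊ y ≟ₚ x ⌋) (nodesFrom (i ∷ p) u) (nodesList p (suc i) us) with branch p x in e
  ... | nothing rewrite occurrences-none x (i ∷ p ⊑_) (nodesFrom (i ∷ p) u) (nodesFrom-⊑ (i ∷ p) u)
                          (λ i∷p⊑x → just≢nothing (trans (sym (child⊑⇒branch i p x i∷p⊑x)) e)) =
    nodesList-unique x p (suc i) us
  ... | just j with j ≟ i
  ...   | no j≢i rewrite occurrences-none x (i ∷ p ⊑_) (nodesFrom (i ∷ p) u) (nodesFrom-⊑ (i ∷ p) u)
                           (λ i∷p⊑x → j≢i (just-injective (trans (sym e) (child⊑⇒branch i p x i∷p⊑x)))) =
    nodesList-unique x p (suc i) us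
  ...   | yes refl rewrite occurrences-none x (BranchFrom p (suc j)) (nodesList p (suc j) us) (nodesList-branch p (suc j) us)
                             (λ { (k , j<k , e') → <-irrefl (just-injective (trans (sym e) e')) j<k }) =
    ≤-trans (≤-reflexive (+-identityʳ _)) (nodesFrom-unique x (j ∷ p) u)

nodesList-∈ : ∀ p j i ts u → nth i ts ≡ just u → ∀ y → y ∈ nodesFrom ((j + i) ∷ p) u → y ∈ nodesList p j ts
nodesList-∈ p j zero (v ∷ ts) u refl y y∈ rewrite +-identityʳ j = ∈-++⁺ˡ y∈
nodesList-∈ p j (suc i) (v ∷ ts) u e y y∈ rewrite +-suc j i =
  ∈-++⁺ʳ (nodesFrom (j ∷ p) v) (nodesList-∈ p (suc j) i ts u e y y∈)

half<⇒1+≤ : ∀ {m d} → ¬ m ≤ 2 * d → 1 + d ≤ m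
half<⇒1+≤ {m} {d} m≰2d = ≤-trans (s≤s (m≤m+n d (d + 0))) (≰⇒> m≰2d)

sumRange : (ℕ → ℕ) → ℕ → ℕ → ℕ
sumRange f a zero = 0
sumRange f a (suc n) = f a + sumRange f (suc a) n

sumRange-snoc : ∀ f a n → sumRange f a (suc n) ≡ sumRange f a n + f (a + n)
sumRange-snoc f a zero rewrite +-identityʳ a = +-comm (f a) 0
sumRange-snoc f a (suc n) rewrite sumRange-snoc f (suc a) n | +-suc a n = sym (+-assoc (f a) _ _)

sumRange-single : ∀ f a → sumRange f a 1 ≡ f a
sumRange-single f a = +-identityʳ (f a)

term≤sumRange : ∀ f a n j → j < n → f (a + j) ≤ sumRange f a n
term≤sumRange f a (suc n) zero _ rewrite +-identityʳ a = m≤m+n (f a) _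
term≤sumRange f a (suc n) (suc j) (s≤s j<n) rewrite +-suc a j =
  ≤-trans (term≤sumRange f (suc a) n j j<n) (m≤n+m _ (f a))

twice-sumRange-snoc : ∀ f a d → 2 * sumRange f a (suc d) ≡ 2 * sumRange f a d + 2 * f (a + d)
twice-sumRange-snoc f a d = trans (cong (2 *_) (sumRange-snoc f a d)) (*-distribˡ-+ 2 (sumRange f a d) (f (a + d)))

sumRange-crossing : ∀ m f a n → 0 < m → m ≤ 2 * sumRange f a n →
                    Σ ℕ λ d → d < n × 2 * sumRange f a d < m × m ≤ 2 * sumRange f a (suc d)
sumRange-crossing m f a zero 0<m m≤0 = ⊥-elim (<-irrefl refl (<-≤-trans 0<m m≤0))
sumRange-crossing m f a (suc n) 0<m m≤s with m ≤? 2 * sumRange f a n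
... | no m≰s' = n , ≤-refl , ≰⇒> m≰s' , m≤s
... | yes m≤s' with sumRange-crossing m f a n 0<m m≤s'
...   | (d , d<n , below , above) = d , m<n⇒m<1+n d<n , below , above

argmax : ∀ (f : ℕ → ℕ) a n → 0 < n → Σ ℕ λ k → k < n × (∀ j → j < n → f (a + j) ≤ f (a + k))
argmax f a (suc zero) _ = 0 , s≤s z≤n , λ { zero _ → ≤-refl ; (suc j) (s≤s ()) }
argmax f a (suc (suc n)) _ with argmax f a (suc n) (s≤s z≤n)
... | (k , k<n , max) with f (a + suc n) ≤? f (a + k)
...   | yes last≤ = k , m<n⇒m<1+n k<n , λ j j<n → [ max j , (λ { refl → last≤ }) ] (m<1+n⇒m<n∨m≡n j<n)
...   | no last≰ = suc n , ≤-refl , λ j j<n →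
          [ (λ j<1+n → ≤-trans (max j j<1+n) (<⇒≤ (≰⇒> last≰))) , (λ { refl → ≤-refl }) ] (m<1+n⇒m<n∨m≡n j<n)

goodInterval : ∀ m f a n → 0 < m → (∀ j → j < n → f (a + j) ≤ m) → m ≤ 2 * sumRange f a n →
               Σ ℕ λ c → Σ ℕ λ len → c + len ≤ n × m ≤ 2 * sumRange f (a + c) len × sumRange f (a + c) len ≤ m
goodInterval m f a n 0<m small large with sumRange-crossing m f a n 0<m large
... | (d , d<n , below , above) with 2 * sumRange f a (suc d) ≤? 2 * m
...   | yes ≤2m = 0 , suc d , d<n , subst (λ z → m ≤ 2 * sumRange f z (suc d)) (sym (+-identityʳ a)) above ,
                 subst (λ z → sumRange f z (suc d) ≤ m) (sym (+-identityʳ a)) (*-cancelˡ-≤ 2 ≤2m)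
...   | no ≰2m = d , 1 , ≤-trans (≤-reflexive (+-comm d 1)) d<n ,
                 subst (m ≤_) (cong (2 *_) (sym (sumRange-single f (a + d)))) lastLarge ,
                 subst (_≤ m) (sym (sumRange-single f (a + d))) (small d d<n)
  where
  -- the prefix before d is below m/2 and the prefix through d is above m, so term d alone is at least m/2
  lastLarge : m ≤ 2 * f (a + d)
  lastLarge with m ≤? 2 * f (a + d)
  ... | yes ok = ok
  ... | no m≰ = ⊥-elim (≰2m (begin
        2 * sumRange f a (suc d)            ≡⟨ twice-sumRange-snoc f a d ⟩
        2 * sumRange f a d + 2 * f (a + d)  ≤⟨ +-mono-≤ (<⇒≤ below) (<⇒≤ (≰⇒> m≰)) ⟩
        m + m                               ≡⟨ cong (m +_) (sym (+-identityʳ m)) ⟩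
        2 * m                               ∎))
    where open ≤-Reasoning

-- The first prefix reaching m/2 works.
goodPrefix : ∀ m f a n → 0 < m → (∀ j → j < n → 2 * f (a + j) ≤ suc m) → m ≤ 2 * sumRange f a n →
             Σ ℕ λ len → len ≤ n × m ≤ 2 * sumRange f a len × sumRange f a len ≤ m
goodPrefix m f a n 0<m small large with sumRange-crossing m f a n 0<m large
... | (d , d<n , below , above) = suc d , d<n , above , *-cancelˡ-≤ 2 (≤-pred (begin
        suc (2 * sumRange f a (suc d))            ≡⟨ cong suc (twice-sumRange-snoc f a d) ⟩
        suc (2 * sumRange f a d) + 2 * f (a + d)  ≤⟨ +-mono-≤ below (small d d<n) ⟩
        m + suc m                                 ≡⟨ +-suc m m ⟩
        suc (m + m)                               ≡⟨ cong (λ z → suc (m + z)) (sym (+-identityʳ m)) ⟩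
        suc (2 * m)                               ∎))
  where open ≤-Reasoning

module Zones (t : Tree) where

  isNode : Pos → Bool
  isNode p = is-just (sub t p)

  ar : Pos → ℕ
  ar p = arity t p

  nth-isJust⇒< : ∀ k (ts : List Tree) → T (is-just (nth k ts)) → k < length ts
  nth-isJust⇒< zero (u ∷ ts) _ = s≤s z≤n
  nth-isJust⇒< (suc k) (u ∷ ts) h = s≤s (nth-isJust⇒< k ts h)

  <⇒nth-isJust : ∀ k (ts : List Tree) → k < length ts → T (is-just (nth k ts))
  <⇒nth-isJust zero (u ∷ ts) _ = tt
  <⇒nth-isJust (suc k) (u ∷ ts) (s≤s h) = <⇒nth-isJust k ts h

  isNode-parent : ∀ k p → T (isNode (k ∷ p)) → T (isNode p)
  isNode-parent k p h with sub t p
  ... | just u = tt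

  isNode-child⇒< : ∀ k p → T (isNode (k ∷ p)) → k < ar p
  isNode-child⇒< k p h with sub t p
  ... | just u = nth-isJust⇒< k (children u) h

  <⇒isNode-child : ∀ k p → k < ar p → T (isNode (k ∷ p))
  <⇒isNode-child k p h with sub t p
  ... | just u = <⇒nth-isJust k (children u) h
  ... | nothing = ⊥-elim (n≮0 h)

  isNode-branch : ∀ r p k → branch r p ≡ just k → T (isNode p) → T (isNode (k ∷ r))
  isNode-branch r (j ∷ p) k e h with branch-∷ r j p k e
  ... | inj₁ (refl , refl) = h
  ... | inj₂ e' = isNode-branch r p k e' (isNode-parent j p h)

  data Scope : Set where
    whole : Scope
    span : Pos → ℕ → ℕ → Scope

  inRange : ℕ → ℕ → ℕ → Bool
  inRange a b k = ⌊ a ≤? k ⌋ ∧ ⌊ k <? b ⌋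

  inScope : Scope → Pos → Bool
  inScope whole p = true
  inScope (span r a b) p = maybe (inRange a b) false (branch r p)

  underHole : Maybe Pos → Pos → Bool
  underHole nothing p = false
  underHole (just h) p = is-just (branch h p)

  -- region (span r a b) (just h): the subtrees at the children a, …, b − 1 of r, without the
  -- proper descendants of h; whole stands for the whole tree and nothing for no removal.
  region : Scope → Maybe Pos → NodeSet
  region sp H p = isNode p ∧ (inScope sp p ∧ not (underHole H p))

  inRange-split : ∀ a c b k → a ≤ c → c ≤ b → χ (inRange a b k) ≡ χ (inRange a c k) + χ (inRange c b k)
  inRange-split a c b k a≤c c≤b with k <? c
  ... | yes k<c rewrite ⌊⌋-false (c ≤? k) (<⇒≱ k<c) | ⌊⌋-true (k <? b) (<-≤-trans k<c c≤b) with ⌊ a ≤? k ⌋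
  ... | true = refl
  ... | false = refl
  inRange-split a c b k a≤c c≤b | no k≮c rewrite ⌊⌋-true (c ≤? k) (≮⇒≥ k≮c) | ⌊⌋-true (a ≤? k) (≤-trans a≤c (≮⇒≥ k≮c))
    with ⌊ k <? b ⌋
  ... | true = refl
  ... | false = refl

  region-split : ∀ r a c b H → a ≤ c → c ≤ b → region (span r a b) H ≐ region (span r a c) H ⊎ region (span r c b) H
  region-split r a c b H a≤c c≤b p with isNode p
  ... | false = refl
  ... | true with branch r p
  ... | nothing = refl
  ... | just k with underHole H p
  ... | false rewrite ∧-identityʳ (inRange a b k) | ∧-identityʳ (inRange a c k) | ∧-identityʳ (inRange c b k) =
    inRange-split a c b k a≤c c≤b
  ... | true rewrite ∧-zeroʳ (inRange a b k) | ∧-zeroʳ (inRange a c k) | ∧-zeroʳ (inRange c b k) = refl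

  inScope-⊏ : ∀ sp x p → T (inScope sp x) → x ⊏ p → T (inScope sp p)
  inScope-⊏ whole x p x∈sp x⊏p = tt
  inScope-⊏ (span r a b) x p x∈sp x⊏p with branch r x in e
  ... | just k with IsJust⇒just _ x⊏p
  ... | (j , e₂) rewrite branch-trans x p r j k e₂ e = x∈sp

  descendants : Pos → Maybe Pos → NodeSet
  descendants x = region (span x 0 (ar x))

  region-cut : ∀ sp H x → T (isNode x) → T (inScope sp x) → (∀ p → T (underHole H p) → x ⊏ p) →
               region sp H ≐ region sp (just x) ⊎ descendants x H
  region-cut sp H x x∈t x∈sp hole⇒below p with isNode p in ep
  ... | false = refl
  ... | true with branch x p in e
  ... | just k rewrite ⌊⌋-true (k <? ar x) (isNode-child⇒< k x (isNode-branch x p k e (≡true⇒T ep)))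
                     | T⇒≡true (inScope-⊏ sp x p x∈sp (just⇒IsJust e)) = refl
  ... | nothing with underHole H p in eh
  ... | true = ⊥-elim (subst IsJust e (hole⇒below p (≡true⇒T eh)))
  ... | false rewrite ∧-identityʳ (inScope sp p) = sym (+-identityʳ _)

  region-hole-outside : ∀ r a b h kh → branch r h ≡ just kh → inRange a b kh ≡ false → ∀ p →
       region (span r a b) (just h) p ≡ region (span r a b) nothing p
  region-hole-outside r a b h kh e1 e2 p with isNode p
  ... | false = refl
  ... | true with branch h p in e
  ... | nothing = refl
  ... | just j rewrite branch-trans h p r j kh e e1 | e2 = refl

  region-single : ∀ r k → T (isNode (k ∷ r)) → ∀ p → region (span r k (suc k)) (just (k ∷ r)) p ≡ ⌊ p ≟ₚ (k ∷ r) ⌋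
  region-single r k k∷r∈t p with p ≟ₚ (k ∷ r)
  ... | yes refl rewrite branch-child r k | branch-self (k ∷ r) | ⌊⌋-true (k ≤? k) ≤-refl | ⌊⌋-true (k <? suc k) ≤-refl
    with isNode (k ∷ r) | k∷r∈t
  ... | true | _ = refl
  region-single r k k∷r∈t p | no p≢k∷r with isNode p
  ... | false = refl
  ... | true with branch r p in e
  ... | nothing = refl
  ... | just j with k ≤? j | j <? suc k
  ... | no _ | _ = refl
  ... | yes _ | no _ = refl
  ... | yes k≤j | yes j<1+k with ≤-antisym k≤j (≤-pred j<1+k)
  ... | refl with branch-split r p k e
  ... | inj₁ p≡k∷r = ⊥-elim (p≢k∷r p≡k∷r)
  ... | inj₂ k∷r⊏p with branch (k ∷ r) p
  ... | just _ = refl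

  region-rootHole : ∀ sp p → χ (region sp (just []) p) ≤ χ ⌊ p ≟ₚ [] ⌋
  region-rootHole sp [] with region sp (just []) []
  ... | true = ≤-refl
  ... | false = z≤n
  region-rootHole sp (j ∷ p) with IsJust⇒just _ ([]⊏∷ j p)
  ... | (k , e) with isNode (j ∷ p)
  ... | false = z≤n
  ... | true rewrite e | ∧-zeroʳ (inScope sp (j ∷ p)) = z≤n

  region-hole-children : ∀ h n p → region (span h 0 n) (just h) p ≡ false
  region-hole-children h n p with isNode p
  ... | false = refl
  ... | true with branch h p
  ... | nothing = refl
  ... | just k = ∧-zeroʳ _

  region⇒isNode : ∀ sp H p → T (region sp H p) → T (isNode p)
  region⇒isNode sp H p h = proj₁ (T-∧⁻ {isNode p} h)

  region⇒inScope : ∀ sp H p → T (region sp H p) → T (inScope sp p)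
  region⇒inScope sp H p h = proj₁ (T-∧⁻ {inScope sp p} (proj₂ (T-∧⁻ {isNode p} h)))

  region⇒¬underHole : ∀ sp H p → T (region sp H p) → ¬ T (underHole H p)
  region⇒¬underHole sp H p h = T-not⁻ (proj₂ (T-∧⁻ {inScope sp p} (proj₂ (T-∧⁻ {isNode p} h))))

  region⁺ : ∀ sp H p → T (isNode p) → T (inScope sp p) → ¬ T (underHole H p) → T (region sp H p)
  region⁺ sp H p a b c = T-∧⁺ a (T-∧⁺ b (T-not⁺ c))

  inRange⁻ : ∀ a b k → T (inRange a b k) → a ≤ k × k < b
  inRange⁻ a b k h with a ≤? k | k <? b
  ... | yes x | yes y = x , y

  inRange⁺ : ∀ a b k → a ≤ k → k < b → T (inRange a b k)
  inRange⁺ a b k x y rewrite ⌊⌋-true (a ≤? k) x | ⌊⌋-true (k <? b) y = tt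

  inRange-false : ∀ a b k → ¬ (a ≤ k × k < b) → inRange a b k ≡ false
  inRange-false a b k k∉ with a ≤? k | k <? b
  ... | yes a≤k | yes k<b = ⊥-elim (k∉ (a≤k , k<b))
  ... | yes _ | no _ = refl
  ... | no _ | _ = refl

  branch⇒inSpan : ∀ r a b p k → branch r p ≡ just k → a ≤ k → k < b → T (inScope (span r a b) p)
  branch⇒inSpan r a b p k e a≤k k<b = subst (λ z → T (maybe (inRange a b) false z)) (sym e) (inRange⁺ a b k a≤k k<b)

  no-hole : ∀ x p → T (underHole nothing p) → x ⊏ p
  no-hole x p ()

  underHole-∷ : ∀ H k p → T (underHole H p) → T (underHole H (k ∷ p))
  underHole-∷ (just h) k p h⊏p with IsJust⇒just _ h⊏p
  ... | (j , e) = just⇒IsJust (branch-extend h p k j e)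

  underHole-sibling : ∀ H i j v → underHole H (i ∷ v) ≡ underHole H (j ∷ v)
  underHole-sibling nothing i j v = refl
  underHole-sibling (just h) i j v with v ≟ₚ h
  ... | yes _ = refl
  ... | no _ = refl

  underHole-boundary : ∀ H k v → T (underHole H (k ∷ v)) → ¬ T (underHole H v) → H ≡ just v
  underHole-boundary (just h) k v h⊏k∷v ¬h⊏v with IsJust⇒just _ h⊏k∷v
  ... | (j , e) with branch-∷ h k v j e
  ... | inj₁ (refl , _) = refl
  ... | inj₂ e' = ⊥-elim (¬h⊏v (just⇒IsJust e'))

  inSpan⁻ : ∀ r a b p → T (inScope (span r a b) p) → Σ ℕ λ k → branch r p ≡ just k × T (inRange a b k)
  inSpan⁻ r a b p h with branch r p
  ... | just k = k , refl , h

  inScope-child : ∀ sp k v → T (inScope sp v) → T (inScope sp (k ∷ v))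
  inScope-child whole k v h = tt
  inScope-child (span r a b) k v h with inSpan⁻ r a b v h
  ... | (j , e , j∈) = subst (λ z → T (maybe (inRange a b) false z)) (sym (branch-extend r v k j e)) j∈

  region-parent : ∀ sp H k p → T (region sp H (k ∷ p)) → T (inScope sp p) → T (region sp H p)
  region-parent sp H k p rkp p∈sp = region⁺ sp H p (isNode-parent k p (region⇒isNode sp H (k ∷ p) rkp)) p∈sp
                                            (λ hp → region⇒¬underHole sp H (k ∷ p) rkp (underHole-∷ H k p hp))

  region-root-span : ∀ sp H k p → T (region sp H (k ∷ p)) → ¬ T (region sp H p) →
          Σ ℕ λ a → Σ ℕ λ b → sp ≡ span p a b × a ≤ k × k < b
  region-root-span whole H k p rk∷p ¬rp =
    ⊥-elim (¬rp (region-parent whole H k p rk∷p tt))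
  region-root-span (span r a b) H k p rk∷p ¬rp with inSpan⁻ r a b (k ∷ p) (region⇒inScope (span r a b) H (k ∷ p) rk∷p)
  ... | (j , e , j∈) with branch-∷ r k p j e
  ... | inj₁ (refl , refl) = a , b , refl , inRange⁻ a b k j∈
  ... | inj₂ e' = ⊥-elim (¬rp (region-parent (span r a b) H k p rk∷p (subst (λ z → T (maybe (inRange a b) false z)) (sym e') j∈)))

  region-root-whole : ∀ sp H → T (region sp H []) → sp ≡ whole
  region-root-whole whole H h = refl
  region-root-whole (span r a b) H h = ⊥-elim (region⇒inScope (span r a b) H [] h)

  isNode⇒IsNode : ∀ p → T (isNode p) → IsNode t p
  isNode⇒IsNode p h with sub t p
  ... | just u = u , refl

  region-rootsSiblings : ∀ sp H p q → IsRootOf (region sp H) p → IsRootOf (region sp H) q →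
                         p ≡ q ⊎ Σ ℕ λ i → Σ ℕ λ j → Σ Pos λ r → p ≡ i ∷ r × q ≡ j ∷ r
  region-rootsSiblings sp H [] [] _ _ = inj₁ refl
  region-rootsSiblings sp H [] (j ∷ q) root (rq , ¬rq') with region-root-whole sp H root | region-root-span sp H j q rq ¬rq'
  ... | refl | (_ , _ , () , _)
  region-rootsSiblings sp H (i ∷ p) [] (rp , ¬rp') root with region-root-whole sp H root | region-root-span sp H i p rp ¬rp'
  ... | refl | (_ , _ , () , _)
  region-rootsSiblings sp H (i ∷ p) (j ∷ q) (rp , ¬rp') (rq , ¬rq')
    with region-root-span sp H i p rp ¬rp' | region-root-span sp H j q rq ¬rq'
  ... | (_ , _ , refl , _) | (_ , _ , refl , _) = inj₂ (i , j , p , refl , refl)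

  region-rootsConsecutive : ∀ sp H r i j k → IsRootOf (region sp H) (i ∷ r) → IsRootOf (region sp H) (j ∷ r) →
                            i ≤ k → k ≤ j → IsRootOf (region sp H) (k ∷ r)
  region-rootsConsecutive sp H r i j k (ri , ¬rr) (rj , _) i≤k k≤j
    with region-root-span sp H i r ri ¬rr | region-root-span sp H j r rj ¬rr
  ... | (a , b , refl , a≤i , _) | (_ , _ , refl , _ , j<b) =
    region⁺ (span r a b) H (k ∷ r)
            (<⇒isNode-child k r (≤-<-trans k≤j (isNode-child⇒< j r (region⇒isNode (span r a b) H (j ∷ r) rj))))
            (subst (λ z → T (maybe (inRange a b) false z)) (sym (branch-child r k))
                   (inRange⁺ a b k (≤-trans a≤i i≤k) (≤-<-trans k≤j j<b)))
            (λ hk → region⇒¬underHole (span r a b) H (i ∷ r) ri (subst T (underHole-sibling H k i r) hk)) ,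
    ¬rr

  region-childrenAllOrNone : ∀ sp H v → T (region sp H v) →
                             (∀ i → i < ar v → ¬ T (region sp H (i ∷ v))) ⊎ (∀ i → i < ar v → T (region sp H (i ∷ v)))
  region-childrenAllOrNone sp H v rv with underHole H (0 ∷ v) in e
  ... | true = inj₁ λ i _ ri → region⇒¬underHole sp H _ ri (subst T (sym (trans (underHole-sibling H i 0 v) e)) tt)
  ... | false = inj₂ λ i i<ar → region⁺ sp H _ (<⇒isNode-child i v i<ar) (inScope-child sp i v (region⇒inScope sp H v rv))
                                         (subst T (trans (underHole-sibling H i 0 v) e))

  region-VC⇒hole : ∀ sp H v → IsVCNode t (region sp H) v → H ≡ just v
  region-VC⇒hole sp H v (rv , 0<ar , none) with underHole H (0 ∷ v) in e
  ... | true = underHole-boundary H 0 v (≡true⇒T e) (region⇒¬underHole sp H v rv)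
  ... | false = ⊥-elim (none 0 0<ar (region⁺ sp H _ (<⇒isNode-child 0 v 0<ar)
                                             (inScope-child sp 0 v (region⇒inScope sp H v rv)) (subst T e)))

  region-isZone : ∀ sp H → (Σ Pos λ p → T (region sp H p)) → Zone t (region sp H)
  region-isZone sp H nonempty = record
    { inTree = λ p rp → isNode⇒IsNode p (region⇒isNode sp H p rp)
    ; nonempty = nonempty
    ; rootsSiblings = region-rootsSiblings sp H
    ; rootsConsecutive = region-rootsConsecutive sp H
    ; childrenAllOrNone = region-childrenAllOrNone sp H
    ; atMostOneVC = λ v w vcv vcw → just-injective (trans (sym (region-VC⇒hole sp H v vcv)) (region-VC⇒hole sp H w vcw))
    }

  nodesFrom-∈ : ∀ x u → sub t x ≡ just u → ∀ y → y ∈ nodesFrom x u → y ∈ nodes t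
  nodesFrom-∈ [] u refl y m = m
  nodesFrom-∈ (i ∷ x) u e y m with sub t x in e'
  ... | just (node ts) = nodesFrom-∈ x (node ts) e' y (there (nodesList-∈ x 0 i ts u e y m))

  isNode⇒∈nodes : ∀ x → T (isNode x) → x ∈ nodes t
  isNode⇒∈nodes x h with sub t x in e
  ... | just u with u
  ... | node ts = nodesFrom-∈ x (node ts) e x (here refl)

  size-singleton : ∀ x → T (isNode x) → size t (λ p → ⌊ p ≟ₚ x ⌋) ≡ 1
  size-singleton x x∈t = ≤-antisym (nodesFrom-unique x [] t)
    (count-∈ (λ p → ⌊ p ≟ₚ x ⌋) (nodes t) x (isNode⇒∈nodes x x∈t) (fromWitness {a? = x ≟ₚ x} refl))

  size-additive : (A B C : NodeSet) → A ≐ B ⊎ C → size t A ≡ size t B + size t C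
  size-additive A B C h = count-additive A B C h (nodes t)

  size-cong : (A B : NodeSet) → (∀ p → A p ≡ B p) → size t A ≡ size t B
  size-cong A B h = count-cong A B h (nodes t)

  size-mono : (A B : NodeSet) → (∀ p → χ (A p) ≤ χ (B p)) → size t A ≤ size t B
  size-mono A B h = count-mono A B h (nodes t)

  weight : Pos → Maybe Pos → ℕ → ℕ
  weight r H k = size t (region (span r k (suc k)) H)

  x≡x+x⇒x≡0 : ∀ x → x ≡ x + x → x ≡ 0
  x≡x+x⇒x≡0 x e = sym (+-cancelˡ-≡ x 0 x (trans (+-identityʳ x) e))

  size-span : ∀ r H a n → size t (region (span r a (a + n)) H) ≡ sumRange (weight r H) a n
  size-span r H a zero rewrite +-identityʳ a = x≡x+x⇒x≡0 _ (size-additive empty empty empty (region-split r a a a H ≤-refl ≤-refl))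
    where empty = region (span r a a) H
  size-span r H a (suc n) = begin
      size t (region (span r a (a + suc n)) H)
        ≡⟨ size-additive _ _ _ (region-split r a (suc a) (a + suc n) H (n≤1+n a)
                                             (subst (suc a ≤_) (sym (+-suc a n)) (s≤s (m≤m+n a n)))) ⟩
      weight r H a + size t (region (span r (suc a) (a + suc n)) H)
        ≡⟨ cong (λ z → weight r H a + size t (region (span r (suc a) z) H)) (+-suc a n) ⟩
      weight r H a + size t (region (span r (suc a) (suc a + n)) H)
        ≡⟨ cong (weight r H a +_) (size-span r H (suc a) n) ⟩
      weight r H a + sumRange (weight r H) (suc a) n ∎
    where open ≡-Reasoning

  underHole⇒⊏ : ∀ x h → x ⊑ h → ∀ p → T (underHole (just h) p) → x ⊏ p
  underHole⇒⊏ x h (inj₁ refl) p h⊏p = h⊏p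
  underHole⇒⊏ x h (inj₂ x⊏h) p h⊏p = ⊏-trans x h p x⊏h h⊏p

  inScope-own : ∀ r k → T (inScope (span r k (suc k)) (k ∷ r))
  inScope-own r k rewrite branch-child r k = inRange⁺ k (suc k) k ≤-refl ≤-refl

  below : Pos → Maybe Pos → ℕ
  below x H = size t (descendants x H)

  weight≡1+below : ∀ r k H → T (isNode (k ∷ r)) → (∀ p → T (underHole H p) → (k ∷ r) ⊏ p) →
          weight r H k ≡ 1 + below (k ∷ r) H
  weight≡1+below r k H k∷r∈t hole⇒below = begin
      weight r H k ≡⟨ size-additive _ _ _ (region-cut (span r k (suc k)) H (k ∷ r) k∷r∈t (inScope-own r k) hole⇒below) ⟩
      size t (region (span r k (suc k)) (just (k ∷ r))) + below (k ∷ r) H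
        ≡⟨ cong (_+ below (k ∷ r) H) (trans (size-cong _ _ (region-single r k k∷r∈t)) (size-singleton (k ∷ r) k∷r∈t)) ⟩
      1 + below (k ∷ r) H ∎
    where open ≡-Reasoning

  weight-hole-elsewhere : ∀ r h k k₀ → branch r h ≡ just k → k₀ ≢ k → weight r (just h) k₀ ≡ weight r nothing k₀
  weight-hole-elsewhere r h k k₀ e k₀≢k =
    size-cong _ _ (region-hole-outside r k₀ (suc k₀) h k e
                    (inRange-false k₀ (suc k₀) k λ (k₀≤k , k<1+k₀) → k₀≢k (≤-antisym k₀≤k (≤-pred k<1+k₀))))

  region-witness : ∀ sp H → 0 < size t (region sp H) → Σ Pos λ p → T (region sp H p)
  region-witness sp H h with count>0⇒witness (region sp H) (nodes t) h
  ... | (p , _ , rp) = p , rp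

  weight-pos⇒isNode : ∀ r k H → 0 < weight r H k → T (isNode (k ∷ r))
  weight-pos⇒isNode r k H 0<weight with region-witness (span r k (suc k)) H 0<weight
  ... | (p , rp) with inSpan⁻ r k (suc k) p (region⇒inScope (span r k (suc k)) H p rp)
  ... | (j , e , j∈) with inRange⁻ k (suc k) j j∈
  ... | (k≤j , j<1+k) with ≤-antisym k≤j (≤-pred j<1+k)
  ... | refl = isNode-branch r p k e (region⇒isNode (span r k (suc k)) H p rp)

  Balanced : ℕ → ℕ → Set
  Balanced m s = m ≤ 2 * s × s ≤ m

  BalancedPieceAt : ℕ → Pos → Set
  BalancedPieceAt m q = Balanced m (below q nothing) ⊎ Σ ℕ λ c → c ≤ ar q × Balanced m (size t (region (span q 0 c) nothing))

  BalancedPieceBelow : ℕ → Pos → Set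
  BalancedPieceBelow m v = Σ Pos λ q → v ⊑ q × T (isNode q) × BalancedPieceAt m q

  ≤⇒≤2* : ∀ {m} x → m ≤ x → m ≤ 2 * x
  ≤⇒≤2* x m≤x = ≤-trans m≤x (m≤m+n x _)

  below≡sumRange : ∀ v → below v nothing ≡ sumRange (weight v nothing) 0 (ar v)
  below≡sumRange v = size-span v nothing 0 (ar v)

  weight-child : ∀ v c → c < ar v → weight v nothing c ≡ 1 + below (c ∷ v) nothing
  weight-child v c c<ar = weight≡1+below v c nothing (<⇒isNode-child c v c<ar) (no-hole (c ∷ v))

  below-child<below : ∀ v c → c < ar v → below (c ∷ v) nothing < below v nothing
  below-child<below v c c<ar = begin-strict
    below (c ∷ v) nothing                 <⟨ n<1+n _ ⟩
    1 + below (c ∷ v) nothing             ≡⟨ sym (weight-child v c c<ar) ⟩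
    weight v nothing c                    ≤⟨ term≤sumRange (weight v nothing) 0 (ar v) c c<ar ⟩
    sumRange (weight v nothing) 0 (ar v)  ≡⟨ sym (below≡sumRange v) ⟩
    below v nothing                       ∎
    where open ≤-Reasoning

  below>m⇒arity-pos : ∀ m v → m < below v nothing → 0 < ar v
  below>m⇒arity-pos m v m<below with ar v | below≡sumRange v
  ... | zero | below≡0 = ⊥-elim (n≮0 (≤-trans m<below (≤-reflexive below≡0)))
  ... | suc _ | _ = s≤s z≤n

  -- If even the heaviest child of v has fewer than m/2 descendants, every child weighs at
  -- most (m + 1)/2, so the first prefix of children of total weight at least m/2 is balanced.
  balancedPrefix : ∀ m v c → 0 < m → m < below v nothing →
                   (∀ j → j < ar v → weight v nothing j ≤ weight v nothing c) → c < ar v →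
                   2 * below (c ∷ v) nothing < m → Σ ℕ λ len → len ≤ ar v × Balanced m (size t (region (span v 0 len) nothing))
  balancedPrefix m v c 0<m heavy max c<ar light =
    fromGoodPrefix (goodPrefix m (weight v nothing) 0 (ar v) 0<m small
                      (≤⇒≤2* _ (≤-trans (<⇒≤ heavy) (≤-reflexive (below≡sumRange v)))))
    where
    small : ∀ j → j < ar v → 2 * weight v nothing j ≤ suc m
    small j j<ar = begin
      2 * weight v nothing j                ≤⟨ *-monoʳ-≤ 2 (max j j<ar) ⟩
      2 * weight v nothing c                ≡⟨ cong (2 *_) (weight-child v c c<ar) ⟩
      2 * (1 + below (c ∷ v) nothing)       ≡⟨ *-distribˡ-+ 2 1 (below (c ∷ v) nothing) ⟩
      2 + 2 * below (c ∷ v) nothing         ≤⟨ s≤s light ⟩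
      suc m                                 ∎
      where open ≤-Reasoning
    fromGoodPrefix : (Σ ℕ λ len → len ≤ ar v × m ≤ 2 * sumRange (weight v nothing) 0 len × sumRange (weight v nothing) 0 len ≤ m) →
                     Σ ℕ λ len → len ≤ ar v × Balanced m (size t (region (span v 0 len) nothing))
    fromGoodPrefix (len , len≤ar , large , small') = len , len≤ar ,
      subst (m ≤_) (cong (2 *_) (sym (size-span v nothing 0 len))) large ,
      subst (_≤ m) (sym (size-span v nothing 0 len)) small'

  -- Descend along heaviest children; the bound decreases strictly on the way down.
  balancedPieceBelow-bounded : ∀ m → 0 < m → ∀ bound v → T (isNode v) → m < below v nothing → below v nothing < bound →
                               BalancedPieceBelow m v
  balancedPieceBelow-bounded m 0<m (suc bound) v v∈t heavy below<bound =
    fromHeaviest (argmax (weight v nothing) 0 (ar v) (below>m⇒arity-pos m v heavy))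
    where
    fromHeaviest : Σ ℕ (λ c → c < ar v × (∀ j → j < ar v → weight v nothing j ≤ weight v nothing c)) → BalancedPieceBelow m v
    fromHeaviest (c , c<ar , max) = byBelow (m ≤? 2 * below (c ∷ v) nothing) (below (c ∷ v) nothing ≤? m)
      where
      c∈t : T (isNode (c ∷ v))
      c∈t = <⇒isNode-child c v c<ar
      v⊑c∷v : v ⊑ c ∷ v
      v⊑c∷v = inj₂ (⊏-child v c)
      byBelow : Dec (m ≤ 2 * below (c ∷ v) nothing) → Dec (below (c ∷ v) nothing ≤ m) → BalancedPieceBelow m v
      byBelow (yes large) (yes small) = c ∷ v , v⊑c∷v , c∈t , inj₁ (large , small)
      byBelow (yes _) (no big)
        with balancedPieceBelow-bounded m 0<m bound (c ∷ v) c∈t (≰⇒> big) (<-≤-trans (below-child<below v c c<ar) (≤-pred below<bound))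
      ... | (q , c∷v⊑q , q∈t , piece) = q , ⊑-trans v (c ∷ v) q v⊑c∷v c∷v⊑q , q∈t , piece
      byBelow (no light) _ = v , inj₁ refl , v∈t , inj₂ (balancedPrefix m v c 0<m heavy max c<ar (≰⇒> light))

  balancedPieceBelow : ∀ m → 0 < m → ∀ r k → m < weight r nothing k → BalancedPieceBelow m (k ∷ r)
  balancedPieceBelow m 0<m r k heavy with below (k ∷ r) nothing ≤? m
  ... | yes small = k ∷ r , inj₁ refl , k∈t , inj₁ (≤⇒≤2* _ (≤-pred (subst (m <_) weight≡ heavy)) , small)
    where
    k∈t : T (isNode (k ∷ r))
    k∈t = weight-pos⇒isNode r k nothing (≤-trans (s≤s z≤n) heavy)
    weight≡ : weight r nothing k ≡ 1 + below (k ∷ r) nothing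
    weight≡ = weight≡1+below r k nothing k∈t (no-hole (k ∷ r))
  ... | no big = balancedPieceBelow-bounded m 0<m (suc (below (k ∷ r) nothing)) (k ∷ r)
                   (weight-pos⇒isNode r k nothing (≤-trans (s≤s z≤n) heavy)) (≰⇒> big) ≤-refl

  module ZoneShape (S : NodeSet) (Z : Zone t S) where
    open Zone Z

    S⇒isNode : ∀ p → T (S p) → T (isNode p)
    S⇒isNode p Sp with inTree p Sp
    ... | (u , e) rewrite e = tt

    rootAbove : ∀ p → T (S p) → Σ Pos λ ρ → ρ ⊑ p × IsRootOf S ρ
    rootAbove [] S[] = [] , inj₁ refl , S[]
    rootAbove (k ∷ p) Sk∷p with S p in e
    ... | false = k ∷ p , inj₁ refl , Sk∷p , ≡false⇒¬T e
    ... | true with rootAbove p (≡true⇒T e)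
    ...   | (ρ , ρ⊑p , root) = ρ , ⊑-trans ρ p (k ∷ p) ρ⊑p (inj₂ (⊏-child p k)) , root

    sibling-root : ∀ ρ k p → IsRootOf S ρ → IsRootOf S (k ∷ p) → Σ ℕ λ i → ρ ≡ i ∷ p
    sibling-root [] k p root₁ root₂ with rootsSiblings [] (k ∷ p) root₁ root₂
    ... | inj₁ ()
    ... | inj₂ (_ , _ , _ , () , _)
    sibling-root (i ∷ q) k p root₁ root₂ with rootsSiblings (i ∷ q) (k ∷ p) root₁ root₂
    ... | inj₁ refl = k , refl
    ... | inj₂ (_ , _ , _ , refl , refl) = i , refl

    rootsInterval : ∀ r k₀ → IsRootOf S (k₀ ∷ r) →
                    Σ ℕ λ a → Σ ℕ λ b → (∀ k → a ≤ k → k < b → IsRootOf S (k ∷ r)) ×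
                                         (∀ k → IsRootOf S (k ∷ r) → a ≤ k × k < b)
    rootsInterval r k₀ root₀@(Sk₀ , ¬Sr) = a , b , inside , bounds
      where
      firstIn = least (λ k → S (k ∷ r)) k₀ Sk₀
      a = proj₁ firstIn
      beyondArity : T (not (S ((suc k₀ + ar r) ∷ r)))
      beyondArity = T-not⁺ λ S∷r → <-irrefl refl (≤-<-trans (m≤n+m (ar r) (suc k₀)) (isNode-child⇒< _ r (S⇒isNode _ S∷r)))
      firstOut = least (λ j → not (S ((suc k₀ + j) ∷ r))) (ar r) beyondArity
      b = suc k₀ + proj₁ firstOut
      inside : ∀ k → a ≤ k → k < b → IsRootOf S (k ∷ r)
      inside k a≤k k<b with k ≤? k₀
      ... | yes k≤k₀ = rootsConsecutive r a k₀ k (proj₁ (proj₂ (proj₂ firstIn)) , ¬Sr) root₀ a≤k k≤k₀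
      ... | no k≰k₀ = subst (λ z → T (S (z ∷ r))) e (¬T-not⇒T (proj₂ (proj₂ (proj₂ firstOut)) (k ∸ suc k₀) j<)) , ¬Sr
        where
        e : suc k₀ + (k ∸ suc k₀) ≡ k
        e = m+[n∸m]≡n (≰⇒> k≰k₀)
        j< : k ∸ suc k₀ < proj₁ firstOut
        j< = +-cancelˡ-< (suc k₀) _ _ (subst (_< b) (sym e) k<b)
      bounds : ∀ k → IsRootOf S (k ∷ r) → a ≤ k × k < b
      bounds k root with a ≤? k | k <? b
      ... | yes a≤k | yes k<b = a≤k , k<b
      ... | no a≰k | _ = ⊥-elim (proj₂ (proj₂ (proj₂ firstIn)) k (≰⇒> a≰k) (proj₁ root))
      ... | _ | no k≮b = ⊥-elim (T-not⁻ (proj₁ (proj₂ (proj₂ firstOut)))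
                          (proj₁ (rootsConsecutive r k₀ k b root₀ root (≤-trans (n≤1+n k₀) (m≤m+n (suc k₀) _)) (≮⇒≥ k≮b))))

    isVC : Pos → Bool
    isVC v = S v ∧ ((0 <ᵇ ar v) ∧ not (S (0 ∷ v)))

    isVC⇒IsVCNode : ∀ v → T (isVC v) → IsVCNode t S v
    isVC⇒IsVCNode v vc with T-∧⁻ {S v} vc
    ... | (Sv , rest) with T-∧⁻ {0 <ᵇ ar v} rest
    ... | (0<ar , ¬S0) with childrenAllOrNone v Sv
    ... | inj₁ none = Sv , <ᵇ⇒< 0 (ar v) 0<ar , none
    ... | inj₂ all = ⊥-elim (T-not⁻ ¬S0 (all 0 (<ᵇ⇒< 0 (ar v) 0<ar)))

    IsVCNode⇒isVC : ∀ v → IsVCNode t S v → T (isVC v)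
    IsVCNode⇒isVC v (Sv , 0<ar , none) = T-∧⁺ Sv (T-∧⁺ (<⇒<ᵇ 0<ar) (T-not⁺ (none 0 0<ar)))

    -- The node whose proper descendants are cut off: the vertical connection node if there is one.
    record Hole : Set where
      field
        hole : Pos
        hole∈S : T (S hole)
        VC≡hole : ∀ v → IsVCNode t S v → v ≡ hole
        nothing-below : ∀ p → T (S p) → ¬ hole ⊏ p

    VC⇒Hole : ∀ h → IsVCNode t S h → Hole
    VC⇒Hole h vc@(Sh , _ , none) = record
      { hole = h ; hole∈S = Sh ; VC≡hole = λ v vcv → atMostOneVC v h vcv vc ; nothing-below = below∉S }
      where
      -- a node of S below h would have, between it and h, a root of S lying strictly below h
      below∉S : ∀ p → T (S p) → ¬ h ⊏ p
      below∉S (k ∷ p) Sk∷p h⊏k∷p with IsJust⇒just _ h⊏k∷p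
      ... | (j , e) with branch-∷ h k p j e
      ... | inj₁ (refl , _) = none k (isNode-child⇒< k h (S⇒isNode _ Sk∷p)) Sk∷p
      ... | inj₂ e' with S p in Sp
      ...   | true = below∉S p (≡true⇒T Sp) (just⇒IsJust e')
      ...   | false with rootAbove h Sh
      ...     | (ρ , ρ⊑h , root) with sibling-root ρ k p root (Sk∷p , ≡false⇒¬T Sp)
      ...       | (i , refl) = <-irrefl refl (<-trans (n<1+n _) (≤-<-trans (⊑⇒length≤ (i ∷ p) h ρ⊑h) (branch⇒length< h p j e')))

    leafBelow : ∀ y u → sub t y ≡ just u → T (S y) → (∀ v → ¬ IsVCNode t S v) → Σ Pos λ h → T (S h) × ar h ≡ 0
    leafBelow y (node []) e Sy noVC = y , Sy , cong (maybe (λ u → length (children u)) 0) e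
    leafBelow y (node (u₀ ∷ us)) e Sy noVC with childrenAllOrNone y Sy
    ... | inj₁ none = ⊥-elim (noVC y (Sy , 0<ar , none))
      where
      0<ar : 0 < ar y
      0<ar rewrite e = s≤s z≤n
    ... | inj₂ all = leafBelow (0 ∷ y) u₀ e₀ (all 0 0<ar) noVC
      where
      0<ar : 0 < ar y
      0<ar rewrite e = s≤s z≤n
      e₀ : sub t (0 ∷ y) ≡ just u₀
      e₀ rewrite e = refl

    leaf⇒Hole : ∀ h → T (S h) → ar h ≡ 0 → (∀ v → ¬ IsVCNode t S v) → Hole
    leaf⇒Hole h Sh leaf noVC = record
      { hole = h ; hole∈S = Sh ; VC≡hole = λ v vc → ⊥-elim (noVC v vc) ; nothing-below = below∉S }
      where
      below∉S : ∀ p → T (S p) → ¬ h ⊏ p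
      below∉S p Sp h⊏p with IsJust⇒just _ h⊏p
      ... | (k , e) = n≮0 (subst (k <_) leaf (isNode-child⇒< k h (isNode-branch h p k e (S⇒isNode p Sp))))

    no-VC : count isVC (nodes t) ≡ 0 → ∀ v → ¬ IsVCNode t S v
    no-VC none v vc = ≡false⇒¬T (count≡0⇒false isVC (nodes t) none v (isNode⇒∈nodes v (S⇒isNode v (proj₁ vc))))
                                (IsVCNode⇒isVC v vc)

    findHole : Hole
    findHole with count isVC (nodes t) in e
    ... | suc _ with count>0⇒witness isVC (nodes t) (subst (0 <_) (sym e) (s≤s z≤n))
    ...   | (h , _ , vc) = VC⇒Hole h (isVC⇒IsVCNode h vc)
    findHole | zero with inTree (proj₁ nonempty) (proj₂ nonempty)
    ... | (u , eu) with leafBelow (proj₁ nonempty) u eu (proj₂ nonempty) (no-VC e)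
    ...   | (h , Sh , leaf) = leaf⇒Hole h Sh leaf (no-VC e)

    module _ (H : Hole) where
      open Hole H

      region-child⇒S : ∀ sp k p → T (S p) → T (region sp (just hole) (k ∷ p)) → T (S (k ∷ p))
      region-child⇒S sp k p Sp rk∷p with childrenAllOrNone p Sp
      ... | inj₂ all = all k (isNode-child⇒< k p (region⇒isNode sp (just hole) (k ∷ p) rk∷p))
      ... | inj₁ none with VC≡hole p (Sp , ≤-<-trans z≤n (isNode-child⇒< k p (region⇒isNode sp (just hole) (k ∷ p) rk∷p)) , none)
      ...   | refl = ⊥-elim (region⇒¬underHole sp (just hole) (k ∷ hole) rk∷p (⊏-child hole k))

      zone-whole : IsRootOf S [] → ∀ p → S p ≡ region whole (just hole) p
      zone-whole S[] p = T-⇔⇒≡ (λ Sp → region⁺ whole (just hole) p (S⇒isNode p Sp) tt (nothing-below p Sp)) (region⇒S p)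
        where
        region⇒S : ∀ p → T (region whole (just hole) p) → T (S p)
        region⇒S [] _ = S[]
        region⇒S (k ∷ p) rk∷p = region-child⇒S whole k p (region⇒S p (region-parent whole (just hole) k p rk∷p tt)) rk∷p

      zone-span : ∀ r k₀ → IsRootOf S (k₀ ∷ r) → Σ ℕ λ a → Σ ℕ λ b → ∀ p → S p ≡ region (span r a b) (just hole) p
      zone-span r k₀ root₀ with rootsInterval r k₀ root₀
      ... | (a , b , inside , bounds) = a , b , λ p → T-⇔⇒≡ (S⇒region p) (region⇒S p)
        where
        inSpan : ∀ p k → branch r p ≡ just k → a ≤ k → k < b → T (inScope (span r a b) p)
        inSpan p k e a≤k k<b = subst (λ z → T (maybe (inRange a b) false z)) (sym e) (inRange⁺ a b k a≤k k<b)
        S⇒region : ∀ p → T (S p) → T (region (span r a b) (just hole) p)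
        S⇒region p Sp with rootAbove p Sp
        ... | (ρ , ρ⊑p , root) with sibling-root ρ k₀ r root root₀
        ...   | (i , refl) = region⁺ (span r a b) (just hole) p (S⇒isNode p Sp)
                               (inSpan p i (child⊑⇒branch i r p ρ⊑p) (proj₁ (bounds i root)) (proj₂ (bounds i root)))
                               (nothing-below p Sp)
        region⇒S : ∀ p → T (region (span r a b) (just hole) p) → T (S p)
        region⇒S [] r[] = ⊥-elim (region⇒inScope (span r a b) (just hole) [] r[])
        region⇒S (k ∷ p) rk∷p with inSpan⁻ r a b (k ∷ p) (region⇒inScope (span r a b) (just hole) (k ∷ p) rk∷p)
        ... | (j , e , j∈) with branch-∷ r k p j e | inRange⁻ a b j j∈
        ...   | inj₁ (refl , refl) | (a≤k , k<b) = proj₁ (inside k a≤k k<b)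
        ...   | inj₂ e' | (a≤j , j<b) =
          region-child⇒S (span r a b) k p (region⇒S p (region-parent (span r a b) (just hole) k p rk∷p (inSpan p j e' a≤j j<b))) rk∷p

    zone≡region : Σ Scope λ sp → Σ Pos λ h → T (S h) × (∀ p → S p ≡ region sp (just h) p)
    zone≡region with rootAbove (proj₁ nonempty) (proj₂ nonempty)
    ... | ([] , _ , root) = whole , hole , hole∈S , zone-whole findHole root
      where open Hole findHole
    ... | (k₀ ∷ r , _ , root) with zone-span findHole r k₀ root
    ...   | (a , b , S≡) = span r a b , hole , hole∈S , S≡
      where open Hole findHole

  Piece : NodeSet → Set
  Piece Z = (∀ p → T (Z p) → T (isNode p)) × ((Σ Pos λ p → T (Z p)) → Zone t Z)

  region-piece : ∀ sp H → Piece (region sp H)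
  region-piece sp H = region⇒isNode sp H , region-isZone sp H

  Σχ : List NodeSet → Pos → ℕ
  Σχ [] p = 0
  Σχ (Z ∷ Zs) p = χ (Z p) + Σχ Zs p

  count≡Σχ : ∀ Zs p → count (λ Z → Z p) Zs ≡ Σχ Zs p
  count≡Σχ [] p = refl
  count≡Σχ (Z ∷ Zs) p rewrite count-∷ (λ Z → Z p) Z Zs | count≡Σχ Zs p = refl

  Σχ-++ : ∀ Xs Ys p → Σχ (Xs ++ Ys) p ≡ Σχ Xs p + Σχ Ys p
  Σχ-++ [] Ys p = refl
  Σχ-++ (X ∷ Xs) Ys p rewrite Σχ-++ Xs Ys p = sym (+-assoc (χ (X p)) _ _)

  Partition : NodeSet → List NodeSet → Set
  Partition A Xs = ∀ p → Σχ Xs p ≡ χ (A p)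

  record Cut (n : ℕ) (A : NodeSet) : Set where
    constructor cut
    field
      pieces : List NodeSet
      pieces-ok : All Piece pieces
      partition : Partition A pieces
      few : length pieces ≤ n

  cut-single : ∀ {A} → Piece A → Cut 1 A
  cut-single {A} ok = cut (A ∷ []) (ok ∷ []) (λ p → +-identityʳ (χ (A p))) ≤-refl

  cut-join : ∀ {A B C i j} → A ≐ B ⊎ C → Cut i B → Cut j C → Cut (i + j) A
  cut-join A≐B⊎C (cut Bs okB partB fewB) (cut Cs okC partC fewC) =
    cut (Bs ++ Cs) (++⁺ okB okC)
        (λ p → trans (Σχ-++ Bs Cs p) (trans (cong₂ _+_ (partB p) (partC p)) (sym (A≐B⊎C p))))
        (≤-trans (≤-reflexive (length-++ Bs)) (+-mono-≤ fewB fewC))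

  region-move-hole : ∀ r c d h k q k₀ → branch r h ≡ just k → ¬ (c ≤ k × k < d) → c ≤ k₀ → k₀ < d →
                     k₀ ∷ r ⊑ q → T (isNode q) →
                     region (span r c d) (just h) ≐ region (span r c d) (just q) ⊎ descendants q nothing
  region-move-hole r c d h k q k₀ e k∉ c≤k₀ k₀<d k₀∷r⊑q q∈t p =
    trans (cong χ (region-hole-outside r c d h k e (inRange-false c d k k∉) p))
          (region-cut (span r c d) nothing q q∈t (branch⇒inSpan r c d q k₀ (child⊑⇒branch k₀ r q k₀∷r⊑q) c≤k₀ k₀<d)
                      (no-hole q) p)

  module Cuts (m : ℕ) (2≤m : 2 ≤ m) where

    0<m : 0 < m
    0<m = ≤-trans (s≤s z≤n) 2≤m

    Good : NodeSet → Set
    Good Z = Balanced m (size t Z)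

    GoodCut : ℕ → NodeSet → Set
    GoodCut n A = Σ (Cut n A) λ c → Any Good (Cut.pieces c)

    goodCut-single : ∀ {A} → Piece A → Good A → GoodCut 1 A
    goodCut-single ok good = cut-single ok , here good

    goodCutˡ : ∀ {A B C i j} → A ≐ B ⊎ C → GoodCut i B → Cut j C → GoodCut (i + j) A
    goodCutˡ A≐B⊎C (cB , goodB) cC = cut-join A≐B⊎C cB cC , any-++⁺ˡ goodB

    goodCutʳ : ∀ {A B C i j} → A ≐ B ⊎ C → Cut i B → GoodCut j C → GoodCut (i + j) A
    goodCutʳ A≐B⊎C cB (cC , goodC) = cut-join A≐B⊎C cB cC , any-++⁺ʳ (Cut.pieces cB) goodC

    goodCut-weaken : ∀ {A i j} → i ≤ j → GoodCut i A → GoodCut j A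
    goodCut-weaken i≤j (cut Xs ok part few , good) = cut Xs ok part (≤-trans few i≤j) , good

    goodCut-cong : ∀ {A B n} → (∀ p → A p ≡ B p) → GoodCut n B → GoodCut n A
    goodCut-cong A≡B (cut Xs ok part few , good) = cut Xs ok (λ p → trans (part p) (cong χ (sym (A≡B p)))) few , good

    descendants-cut : ∀ q → BalancedPieceAt m q → GoodCut 2 (descendants q nothing)
    descendants-cut q (inj₁ good) = goodCut-weaken (n≤1+n 1) (goodCut-single (region-piece (span q 0 (ar q)) nothing) good)
    descendants-cut q (inj₂ (c , c≤ar , good)) =
      goodCutˡ (region-split q 0 c (ar q) nothing z≤n c≤ar)
               (goodCut-single (region-piece (span q 0 c) nothing) good)
               (cut-single (region-piece (span q c (ar q)) nothing))

    lightSpan : ∀ r a n H → (∀ j → j < n → weight r H (a + j) ≤ m) → m < size t (region (span r a (a + n)) H) →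
                GoodCut 4 (region (span r a (a + n)) H)
    lightSpan r a n H light heavy
      with goodInterval m (weight r H) a n 0<m light (≤⇒≤2* _ (≤-trans (<⇒≤ heavy) (≤-reflexive (size-span r H a n))))
    ... | (c , len , c+len≤n , large , small) = goodCut-weaken (n≤1+n 3)
      (goodCutʳ (region-split r a (a + c) (a + n) H (m≤m+n a c) (+-monoʳ-≤ a (≤-trans (m≤m+n c len) c+len≤n)))
         (cut-single (region-piece (span r a (a + c)) H))
         (goodCutˡ (region-split r (a + c) (a + c + len) (a + n) H (m≤m+n (a + c) len)
                                 (≤-trans (≤-reflexive (+-assoc a c len)) (+-monoʳ-≤ a c+len≤n)))
            (goodCut-single (region-piece (span r (a + c) (a + c + len)) H)
                            (subst (Balanced m) (sym (size-span r H (a + c) len)) (large , small)))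
            (cut-single (region-piece (span r (a + c + len) (a + n)) H))))

    -- The heavy child k₀ is not on the path to h, so the cut-out part of S can be moved to the
    -- balanced node q below k₀, on whichever side of k₀ avoids h.
    heavySpan : ∀ r a n h k k₀ → branch r h ≡ just k → k₀ ≢ k → a ≤ k₀ → k₀ < a + n → m < weight r nothing k₀ →
                GoodCut 4 (region (span r a (a + n)) (just h))
    heavySpan r a n h k k₀ e k₀≢k a≤k₀ k₀<b heavy with balancedPieceBelow m 0<m r k₀ heavy
    ... | (q , k₀∷r⊑q , q∈t , piece) with <-cmp k₀ k
    ...   | tri≈ _ k₀≡k _ = ⊥-elim (k₀≢k k₀≡k)
    ...   | tri< k₀<k _ _ =
      goodCutˡ (region-split r a (suc k₀) (a + n) (just h) (≤-trans a≤k₀ (n≤1+n k₀)) k₀<b)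
        (goodCutʳ (region-move-hole r a (suc k₀) h k q k₀ e (λ (_ , k<1+k₀) → <⇒≱ k₀<k (≤-pred k<1+k₀))
                                    a≤k₀ ≤-refl k₀∷r⊑q q∈t)
           (cut-single (region-piece (span r a (suc k₀)) (just q)))
           (descendants-cut q piece))
        (cut-single (region-piece (span r (suc k₀) (a + n)) (just h)))
    ...   | tri> _ _ k<k₀ =
      goodCutʳ (region-split r a k₀ (a + n) (just h) a≤k₀ (<⇒≤ k₀<b))
        (cut-single (region-piece (span r a k₀) (just h)))
        (goodCutʳ (region-move-hole r k₀ (a + n) h k q k₀ e (λ (k₀≤k , _) → <⇒≱ k<k₀ k₀≤k)
                                    ≤-refl k₀<b k₀∷r⊑q q∈t)
           (cut-single (region-piece (span r k₀ (a + n)) (just q)))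
           (descendants-cut q piece))

    splitSpan : ∀ r a n h k → branch r h ≡ just k → a ≤ k → k < a + n → weight r (just h) k ≤ m →
                m < size t (region (span r a (a + n)) (just h)) → GoodCut 4 (region (span r a (a + n)) (just h))
    splitSpan r a n h k e a≤k k<a+n light-k heavy
      with argmax (weight r (just h)) a n (+-cancelˡ-< a 0 n (subst (_< a + n) (sym (+-identityʳ a)) (≤-<-trans a≤k k<a+n)))
    ... | (j₀ , j₀<n , max) with weight r (just h) (a + j₀) ≤? m
    ...   | yes light = lightSpan r a n (just h) (λ j j<n → ≤-trans (max j j<n) light) heavy
    ...   | no heavy₀ = heavySpan r a n h k (a + j₀) e k₀≢k (m≤m+n a j₀) (+-monoʳ-< a j₀<n)
                          (subst (m <_) (weight-hole-elsewhere r h k (a + j₀) e k₀≢k) (≰⇒> heavy₀))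
      where
      k₀≢k : a + j₀ ≢ k
      k₀≢k k₀≡k = heavy₀ (subst (λ z → weight r (just h) z ≤ m) (sym k₀≡k) light-k)

    dropEmpty : ∀ {S} → GoodCut 5 S →
                Σ (List NodeSet) λ Ss → IsPartition S Ss × length Ss ≤ 5 × All (Zone t) Ss × Any Good Ss
    dropEmpty (cut Zs ok part few , good) =
      filterᵇ nonEmpty Zs ,
      (λ p → trans (count≡Σχ (filterᵇ nonEmpty Zs) p) (trans (Σχ-nonEmpty Zs ok p) (part p))) ,
      ≤-trans (length-filter (T? ∘ nonEmpty) Zs) few ,
      zones-nonEmpty Zs ok ,
      good-nonEmpty Zs good
      where
      nonEmpty : NodeSet → Bool
      nonEmpty Z = 0 <ᵇ size t Z

      empty⇒false : ∀ Z → Piece Z → nonEmpty Z ≡ false → ∀ p → Z p ≡ false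
      empty⇒false Z (Z⊆t , _) e p with Z p in Zp
      ... | false = refl
      ... | true = ⊥-elim (≡false⇒¬T e (<⇒<ᵇ (count-∈ Z (nodes t) p (isNode⇒∈nodes p (Z⊆t p (≡true⇒T Zp)))
                                                                    (≡true⇒T Zp))))

      Σχ-nonEmpty : ∀ Zs → All Piece Zs → ∀ p → Σχ (filterᵇ nonEmpty Zs) p ≡ Σχ Zs p
      Σχ-nonEmpty [] [] p = refl
      Σχ-nonEmpty (Z ∷ Zs) (ok ∷ oks) p with nonEmpty Z in e
      ... | true = cong (χ (Z p) +_) (Σχ-nonEmpty Zs oks p)
      ... | false rewrite empty⇒false Z ok e p = Σχ-nonEmpty Zs oks p

      zones-nonEmpty : ∀ Zs → All Piece Zs → All (Zone t) (filterᵇ nonEmpty Zs)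
      zones-nonEmpty [] [] = []
      zones-nonEmpty (Z ∷ Zs) ((_ , isZone) ∷ oks) with nonEmpty Z in e
      ... | false = zones-nonEmpty Zs oks
      ... | true with count>0⇒witness Z (nodes t) (<ᵇ⇒< 0 _ (≡true⇒T e))
      ...   | (p , _ , Zp) = isZone (p , Zp) ∷ zones-nonEmpty Zs oks

      good⇒nonEmpty : ∀ Z → Good Z → nonEmpty Z ≡ true
      good⇒nonEmpty Z (large , _) with size t Z
      ... | zero = ⊥-elim (<-irrefl refl (≤-trans 2≤m (≤-trans large z≤n)))
      ... | suc _ = refl

      good-nonEmpty : ∀ Zs → Any Good Zs → Any Good (filterᵇ nonEmpty Zs)
      good-nonEmpty (Z ∷ Zs) (here good) rewrite good⇒nonEmpty Z good = here good
      good-nonEmpty (Z ∷ Zs) (there good) with nonEmpty Z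
      ... | true = there (good-nonEmpty Zs good)
      ... | false = good-nonEmpty Zs good

  module Decomposition (m : ℕ) (2≤m : 2 ≤ m) (h : Pos) where
    open Cuts m 2≤m

    record Summit (sp : Scope) : Set where
      field
        x : Pos
        x∈S : T (region sp (just h) x)
        x⊑h : x ⊑ h
        x-small : below x (just h) ≤ m
        maximal : x ≡ [] ⊎ Σ ℕ λ k → Σ Pos λ x' → x ≡ k ∷ x' ×
                  (¬ T (region sp (just h) x') ⊎ (T (region sp (just h) x') × m < below x' (just h)))

    climb : ∀ sp x → T (region sp (just h) x) → x ⊑ h → below x (just h) ≤ m → Summit sp
    climb sp [] x∈S x⊑h small = record { x = [] ; x∈S = x∈S ; x⊑h = x⊑h ; x-small = small ; maximal = inj₁ refl }
    climb sp (k ∷ x') x∈S x⊑h small with T? (region sp (just h) x')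
    ... | no x'∉S = record { x = k ∷ x' ; x∈S = x∈S ; x⊑h = x⊑h ; x-small = small ; maximal = inj₂ (k , x' , refl , inj₁ x'∉S) }
    ... | yes x'∈S with below x' (just h) ≤? m
    ...   | yes small' = climb sp x' x'∈S (⊑-trans x' (k ∷ x') h (inj₂ (⊏-child x' k)) x⊑h) small'
    ...   | no big = record { x = k ∷ x' ; x∈S = x∈S ; x⊑h = x⊑h ; x-small = small
                            ; maximal = inj₂ (k , x' , refl , inj₂ (x'∈S , ≰⇒> big)) }

    below-hole : below h (just h) ≡ 0
    below-hole = trans (size-cong _ (λ _ → false) (region-hole-children h (ar h))) (count-const-false (nodes t))

    weight≡1+below-on-path : ∀ sp k x' → T (region sp (just h) (k ∷ x')) → k ∷ x' ⊑ h →
                             weight x' (just h) k ≡ 1 + below (k ∷ x') (just h)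
    weight≡1+below-on-path sp k x' x∈S x⊑h =
      weight≡1+below x' k (just h) (region⇒isNode sp (just h) (k ∷ x') x∈S) (underHole⇒⊏ (k ∷ x') h x⊑h)

    root-too-small : ∀ sp → T (region sp (just h) []) → [] ⊑ h → 1 + below [] (just h) ≤ m → ¬ m < size t (region sp (just h))
    root-too-small sp []∈S []⊑h small heavy = <-irrefl refl (<-≤-trans heavy (≤-trans size≤ small))
      where
      size≤ : size t (region sp (just h)) ≤ 1 + below [] (just h)
      size≤ = begin
        size t (region sp (just h))
          ≡⟨ size-additive (region sp (just h)) (region sp (just [])) (descendants [] (just h))
               (region-cut sp (just h) [] tt (region⇒inScope sp (just h) [] []∈S) (underHole⇒⊏ [] h []⊑h)) ⟩
        size t (region sp (just [])) + below [] (just h)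
          ≤⟨ +-monoˡ-≤ (below [] (just h)) (≤-trans (size-mono (region sp (just [])) (λ p → ⌊ p ≟ₚ [] ⌋) (region-rootHole sp))
                                                  (≤-reflexive (size-singleton [] tt))) ⟩
        1 + below [] (just h) ∎
        where open ≤-Reasoning

    cut-at-root : ∀ sp k x' → T (region sp (just h) (k ∷ x')) → ¬ T (region sp (just h) x') → k ∷ x' ⊑ h →
                  1 + below (k ∷ x') (just h) ≤ m → m < size t (region sp (just h)) → GoodCut 5 (region sp (just h))
    cut-at-root sp k x' x∈S x'∉S x⊑h small heavy with region-root-span sp (just h) k x' x∈S x'∉S
    ... | (a , b , refl , a≤k , k<b) =
      subst (λ b → GoodCut 5 (region (span x' a b) (just h))) a+[b∸a]≡b
        (goodCut-weaken (n≤1+n 4)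
          (splitSpan x' a (b ∸ a) h k (child⊑⇒branch k x' h x⊑h) a≤k (subst (k <_) (sym a+[b∸a]≡b) k<b)
             (≤-trans (≤-reflexive (weight≡1+below-on-path (span x' a b) k x' x∈S x⊑h)) small)
             (subst (λ b → m < size t (region (span x' a b) (just h))) (sym a+[b∸a]≡b) heavy)))
      where
      a+[b∸a]≡b : a + (b ∸ a) ≡ b
      a+[b∸a]≡b = m+[n∸m]≡n (≤-trans a≤k (<⇒≤ k<b))

    cut-at-parent : ∀ sp k x' → T (region sp (just h) (k ∷ x')) → T (region sp (just h) x') → k ∷ x' ⊑ h →
                    1 + below (k ∷ x') (just h) ≤ m → m < below x' (just h) → GoodCut 5 (region sp (just h))
    cut-at-parent sp k x' x∈S x'∈S x⊑h small heavy =
      goodCutʳ (region-cut sp (just h) x' (region⇒isNode sp (just h) x' x'∈S) (region⇒inScope sp (just h) x' x'∈S)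
                           (underHole⇒⊏ x' h (⊑-trans x' (k ∷ x') h (inj₂ (⊏-child x' k)) x⊑h)))
        (cut-single (region-piece sp (just x')))
        (splitSpan x' 0 (ar x') h k (child⊑⇒branch k x' h x⊑h) z≤n
           (isNode-child⇒< k x' (region⇒isNode sp (just h) (k ∷ x') x∈S))
           (≤-trans (≤-reflexive (weight≡1+below-on-path sp k x' x∈S x⊑h)) small) heavy)

    decompose : ∀ sp → T (region sp (just h) h) → m < size t (region sp (just h)) → GoodCut 5 (region sp (just h))
    decompose sp h∈S heavy with climb sp h h∈S (inj₁ refl) (subst (_≤ m) (sym below-hole) z≤n)
    ... | record { x = x ; x∈S = x∈S ; x⊑h = x⊑h ; x-small = small ; maximal = maximal } with m ≤? 2 * below x (just h)
    ...   | yes large = goodCut-weaken (s≤s (s≤s z≤n))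
              (goodCutʳ (region-cut sp (just h) x (region⇒isNode sp (just h) x x∈S) (region⇒inScope sp (just h) x x∈S)
                                    (underHole⇒⊏ x h x⊑h))
                 (cut-single (region-piece sp (just x)))
                 (goodCut-single (region-piece (span x 0 (ar x)) (just h)) (large , small)))
    ...   | no light with maximal
    ...     | inj₁ refl = ⊥-elim (root-too-small sp x∈S x⊑h (half<⇒1+≤ light) heavy)
    ...     | inj₂ (k , x' , refl , inj₁ x'∉S) = cut-at-root sp k x' x∈S x'∉S x⊑h (half<⇒1+≤ light) heavy
    ...     | inj₂ (k , x' , refl , inj₂ (x'∈S , heavy')) = cut-at-parent sp k x' x∈S x'∈S x⊑h (half<⇒1+≤ light) heavy'

lemma2 : (t : Tree) (m : ℕ) (S : NodeSet) → 2 ≤ m → Zone t S → m < size t S →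
    Σ (List NodeSet) λ Ss → IsPartition S Ss × length Ss ≤ 5 × All (Zone t) Ss ×
    Any (λ Z → m ≤ 2 * size t Z × size t Z ≤ m) Ss
lemma2 t m S 2≤m Z heavy with Zones.ZoneShape.zone≡region t S Z
... | (sp , h , h∈S , S≡region) =
  dropEmpty (goodCut-cong S≡region (decompose sp (subst T (S≡region h) h∈S) (subst (m <_) (size-cong S _ S≡region) heavy)))
  where
  open Zones t
  open Cuts m 2≤m
  open Decomposition m 2≤m h
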